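{- Let $p_1p_2\cdots p_z$ be the LZMW parsing of a string. Then for any $i\in[2..z]$ and $j\in[i+2..z]$ we have $p_{i-1}p_i\ne p_{j-1}p_j$.
   Context: For a string $s$ of length $n$ over alphabet $\Sigma$ (by convention ending with a unique letter $\$$), the LZMW parsing is $s=p_1\cdots p_z$ where, for each $i$, with $k=|p_1\cdots p_{i-1}|+1$, $p_i$ is the longest prefix of $s[k..n]$ belonging to $\{p_jp_{j+1}: 1\le j\le i-2\}\cup\Sigma$. $[a..b]$ denotes the set of integers $k$ with $a\le k\le b$. -}

module Defs where

open import Data.Nat using (ℕ; zero; suc; _≤_; _+_; _∸_)
open import Data.List using (List; []; _∷_; _++_; [_]; length)
open import Data.List.Membership.Propositional using (_∈_)
open import Data.Product using (Σ; ∃; _×_; _,_)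
open import Data.Sum using (_⊎_)
open import Relation.Binary.PropositionalEquality using (_≡_)
open import Relation.Nullary using (¬_)

-- Phrases are indexed 1-based by ℕ: p 1, p 2, …, p z.
-- (Values of p outside [1..z] are irrelevant.)

concatUpTo : {A : Set} → (ℕ → List A) → ℕ → List A
concatUpTo p zero    = []
concatUpTo p (suc k) = concatUpTo p k ++ p (suc k)

InDict : {A : Set} → (ℕ → List A) → ℕ → List A → Set
InDict {A} p i w =
  (Σ ℕ λ j → (1 ≤ j) × (j + 2 ≤ i) × (w ≡ p j ++ p (suc j)))
  ⊎ (Σ A λ a → w ≡ [ a ])

EndsWithUniqueLetter : {A : Set} → List A → Set
EndsWithUniqueLetter {A} s =
  Σ (List A) λ s' → Σ A λ d → (s ≡ s' ++ [ d ]) × ¬ (d ∈ s')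

record IsLZMWParsing {A : Set} (s : List A) (z : ℕ) (p : ℕ → List A) : Set where
  field
    covers   : s ≡ concatUpTo p z
    inDict   : ∀ i → 1 ≤ i → i ≤ z → InDict p i (p i)
    longest  : ∀ i → 1 ≤ i → i ≤ z → ∀ (w t : List A) →
               InDict p i w → concatUpTo p (i ∸ 1) ++ w ++ t ≡ s →
               length w ≤ length (p i)

-- If p_{i-1} p_i = p_{j-1} p_j with j ≥ i + 2, then at step j - 1 the word
-- p_{i-1} p_i is already in the dictionary and is a prefix of the remaining text
-- p_{j-1} p_j ⋯.  Since every phrase is non-empty it is strictly longer than
-- p_{j-1}, contradicting the greedy choice of p_{j-1}.
module Submission where

open import Defs
open import Data.Nat using (ℕ; suc; _≤_; _<_; _+_; _∸_; s≤s; z≤n; _≤′_; ≤′-refl; ≤′-step)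
open import Data.Nat.Properties using (≤⇒≤′; ≤-reflexive; ≤-trans; m≤m+n; m<m+n; <-≤-trans; <-irrefl; +-monoʳ-<; +-identityʳ; n≤1+n; module ≤-Reasoning)
open import Data.Nat.Induction using (<-rec)
open import Data.List using (List; []; _++_; length)
open import Data.List.Properties using (++-assoc; ++-identityʳ; length-++)
open import Data.Product using (∃; _,_; proj₁; proj₂)
open import Data.Sum using (inj₁; inj₂)
open import Relation.Binary.PropositionalEquality using (_≡_; _≢_; refl; sym; trans; cong; module ≡-Reasoning)
open import Relation.Nullary using (¬_)

module _ {A : Set} (p : ℕ → List A) where

  concatUpTo-prefix : ∀ {k n} → k ≤′ n → ∃ λ t → concatUpTo p k ++ t ≡ concatUpTo p n
  concatUpTo-prefix ≤′-refl = [] , ++-identityʳ _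
  concatUpTo-prefix {k} {suc n} (≤′-step k≤′n) with concatUpTo-prefix k≤′n
  ... | t , eq = t ++ p (suc n) , trans (sym (++-assoc (concatUpTo p k) t (p (suc n))))
                                        (cong (_++ p (suc n)) eq)

  InDict-nonEmpty : ∀ {i w} → (∀ j → 1 ≤ j → j + 2 ≤ i → 0 < length (p j)) →
                    InDict p i w → 0 < length w
  InDict-nonEmpty _ (inj₂ (a , refl)) = s≤s z≤n
  InDict-nonEmpty nonEmpty (inj₁ (j , 1≤j , j+2≤i , refl)) =
    <-≤-trans (nonEmpty j 1≤j j+2≤i)
              (≤-trans (m≤m+n _ _) (≤-reflexive (sym (length-++ (p j)))))

module _ {A : Set} {s : List A} {z : ℕ} {p : ℕ → List A} (P : IsLZMWParsing s z p) where
  open IsLZMWParsing P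

  phrase-nonEmpty : ∀ i → 1 ≤ i → i ≤ z → 0 < length (p i)
  phrase-nonEmpty = <-rec (λ i → 1 ≤ i → i ≤ z → 0 < length (p i)) step
    where
    step : ∀ i → (∀ {j} → j < i → 1 ≤ j → j ≤ z → 0 < length (p j)) →
           1 ≤ i → i ≤ z → 0 < length (p i)
    step i rec 1≤i i≤z = InDict-nonEmpty p earlier (inDict i 1≤i i≤z)
      where
      earlier : ∀ j → 1 ≤ j → j + 2 ≤ i → 0 < length (p j)
      earlier j 1≤j j+2≤i = rec (<-≤-trans (m<m+n j (s≤s z≤n)) j+2≤i) 1≤j
                                (≤-trans (≤-trans (m≤m+n j 2) j+2≤i) i≤z)

  next-pair-∉-dict : ∀ k → suc (suc k) ≤ z → ¬ InDict p (suc k) (p (suc k) ++ p (suc (suc k)))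
  next-pair-∉-dict k k+2≤z inPair = <-irrefl refl (<-≤-trans longer notLonger)
    where
    pair : List A
    pair = p (suc k) ++ p (suc (suc k))
    t : List A
    t = proj₁ (concatUpTo-prefix p (≤⇒≤′ k+2≤z))
    pair-prefix : concatUpTo p k ++ pair ++ t ≡ s
    pair-prefix = begin
      concatUpTo p k ++ pair ++ t                         ≡⟨ cong (concatUpTo p k ++_) (++-assoc (p (suc k)) _ t) ⟩
      concatUpTo p k ++ p (suc k) ++ p (suc (suc k)) ++ t ≡⟨ sym (++-assoc (concatUpTo p k) _ _) ⟩
      concatUpTo p (suc k) ++ p (suc (suc k)) ++ t        ≡⟨ sym (++-assoc (concatUpTo p (suc k)) _ t) ⟩
      concatUpTo p (suc (suc k)) ++ t                     ≡⟨ proj₂ (concatUpTo-prefix p (≤⇒≤′ k+2≤z)) ⟩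
      concatUpTo p z                                      ≡⟨ sym covers ⟩
      s                                                   ∎
      where open ≡-Reasoning
    notLonger : length pair ≤ length (p (suc k))
    notLonger = longest (suc k) (s≤s z≤n) (≤-trans (n≤1+n _) k+2≤z) pair t inPair pair-prefix
    longer : length (p (suc k)) < length pair
    longer = begin-strict
      length (p (suc k))                             ≡⟨ sym (+-identityʳ _) ⟩
      length (p (suc k)) + 0                         <⟨ +-monoʳ-< _ (phrase-nonEmpty (suc (suc k)) (s≤s z≤n) k+2≤z) ⟩
      length (p (suc k)) + length (p (suc (suc k))) ≡⟨ sym (length-++ (p (suc k))) ⟩
      length pair                                    ∎
      where open ≤-Reasoning

lemma3 : {A : Set} (s : List A) (z : ℕ) (p : ℕ → List A) →
         EndsWithUniqueLetter s → IsLZMWParsing s z p →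
         ∀ i j → 2 ≤ i → i ≤ z → i + 2 ≤ j → j ≤ z →
         p (i ∸ 1) ++ p i ≢ p (j ∸ 1) ++ p j
lemma3 s z p _ P (suc (suc a)) (suc (suc m)) (s≤s (s≤s _)) _ (s≤s i+1≤m+1) j≤z samePair =
  next-pair-∉-dict P m j≤z (inj₁ (suc a , s≤s z≤n , i+1≤m+1 , sym samePair))
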